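{- Let $\mathrm{PR}$ be the set of standard defining equations for all primitive recursive functions, and let $\mathbf{A}(\mathrm{PR})$ be the theory defined below. Then: (1) for every functional symbol $\mathsf{f}$ of $\mathrm{PR}$, $\mathbf{A}(\mathrm{PR})\vdash_{b}\forall\vec{x}\,\exists y\;\mathsf{f}(\vec{x})=y$; (2) for every primitive recursive term $t[\vec{x}]$ (a term in the language of $\mathrm{PR}$ whose variables are among $\vec x$), $\mathbf{A}(\mathrm{PR})\vdash_{b}\forall\vec{x}\,\exists y\;t[\vec{x}]=y$; (3) for every formula $A$ in the language of $\mathbf{A}(\mathrm{PR})$, if $\mathbf{A}(\mathrm{PR})\vdash A$ then $\mathbf{A}(\mathrm{PR})\vdash_{b} A$.
   Context: For a set $P$ of first-order equations, let $\mathcal{L}$ be the language of $P$ together with a constant $\mathsf{0}$ and a unary function symbol $\mathsf{S}$. The theory $\mathbf{A}(P)$ is the first-order theory with equality in $\mathcal{L}$ whose axioms are: the universal closures of the equations in $P$; the separation axioms $\forall x\;\mathsf{S}(x)\neq\mathsf{0}$ and $\forall x,y\;(\mathsf{S}(x)=\mathsf{S}(y)\to x=y)$; and the induction axiom $A[\mathsf{0}]\to\forall x\,(A[x]\to A[\mathsf{S}(x)])\to\forall x\,A[x]$ for every formula $A$ of $\mathcal{L}$. Derivations use classical natural deduction with the usual quantifier rules ($\forall$-introduction, $\forall$-elimination from $\forall x\,A[x]$ to $A[t]$, $\exists$-introduction from $A[t]$ to $\exists x\,A[x]$, $\exists$-elimination) plus the equality rules: from $A[t]$ and $t=s$ infer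 $A[s]$ (replacing some occurrences of $t$ by $s$), and $t=t$ as an axiom. $\mathrm{PR}$ is the set of standard defining equations of all primitive recursive functions (one function symbol per primitive recursive definition), so $\mathbf{A}(\mathrm{PR})$ is Peano Arithmetic with all primitive recursive function symbols. A term is basic if it is built from $\mathsf{0}$, $\mathsf{S}$ and variables only. $T\vdash_{b}\Gamma\Rightarrow A$ means there is a classical natural deduction derivation in $T$ of $A$ from open assumptions $\Gamma$ in which every term $t$ used in a $\forall$-elimination or $\exists$-introduction rule is basic; $T\vdash_b A$ means this with $\Gamma$ empty. $\vdash$ denotes ordinary derivability. -}

module Defs where

open import Data.Nat using (ℕ; zero; suc; _<_)
open import Data.Fin using (Fin; toℕ)
open import Data.Vec using (Vec; []; _∷_; tabulate)
import Data.Vec as V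
open import Data.List using (List; map)
open import Data.List.Membership.Propositional using (_∈_)
open import Data.Unit using (⊤)
open import Data.Product using (_×_)
open import Function using (_∘_)

-- Primitive recursive function symbols (one per p.r. definition),
-- indexed by arity.

data PR : ℕ → Set where
  Z    : PR 0
  Sc   : PR 1
  Proj : (n : ℕ) → Fin n → PR n
  Comp : ∀ {k n} → PR k → Vec (PR n) k → PR n
  Rec  : ∀ {n} → PR n → PR (suc (suc n)) → PR (suc n)
    -- Rec g h (0, x⃗) = g(x⃗);  Rec g h (S y, x⃗) = h(y, Rec g h (y, x⃗), x⃗)

-- Terms of the language L (de Bruijn variables)

data Term : Set where
  var  : ℕ → Term
  𝟎    : Term
  S    : Term → Term
  app  : ∀ {n} → PR n → Vec Term n → Term

mutual
  subT : (ℕ → Term) → Term → Term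
  subT σ (var x)    = σ x
  subT σ 𝟎          = 𝟎
  subT σ (S t)      = S (subT σ t)
  subT σ (app f ts) = app f (subTs σ ts)

  subTs : ∀ {n} → (ℕ → Term) → Vec Term n → Vec Term n
  subTs σ []       = []
  subTs σ (t ∷ ts) = subT σ t ∷ subTs σ ts

wkT : Term → Term
wkT = subT (var ∘ suc)

data Basic : Term → Set where
  b-var : ∀ x → Basic (var x)
  b-𝟎   : Basic 𝟎
  b-S   : ∀ {t} → Basic t → Basic (S t)

mutual
  VarsBelow : ℕ → Term → Set
  VarsBelow n (var x)    = x < n
  VarsBelow n 𝟎          = ⊤
  VarsBelow n (S t)      = VarsBelow n t
  VarsBelow n (app f ts) = VarsBelowV n ts

  VarsBelowV : ∀ {k} → ℕ → Vec Term k → Set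
  VarsBelowV n []       = ⊤
  VarsBelowV n (t ∷ ts) = VarsBelow n t × VarsBelowV n ts

infix  7 _≐_
infixr 5 _∧'_
infixr 4 _∨'_
infixr 3 _⇒_

data Formula : Set where
  _≐_  : Term → Term → Formula
  ⊥'   : Formula
  _⇒_  : Formula → Formula → Formula
  _∧'_ : Formula → Formula → Formula
  _∨'_ : Formula → Formula → Formula
  ∀'   : Formula → Formula
  ∃'   : Formula → Formula

¬' : Formula → Formula
¬' A = A ⇒ ⊥'

liftσ : (ℕ → Term) → ℕ → Term
liftσ σ zero    = var zero
liftσ σ (suc x) = wkT (σ x)

subF : (ℕ → Term) → Formula → Formula
subF σ (t ≐ s)  = subT σ t ≐ subT σ s
subF σ ⊥'       = ⊥'
subF σ (A ⇒ B)  = subF σ A ⇒ subF σ B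
subF σ (A ∧' B) = subF σ A ∧' subF σ B
subF σ (A ∨' B) = subF σ A ∨' subF σ B
subF σ (∀' A)   = ∀' (subF (liftσ σ) A)
subF σ (∃' A)   = ∃' (subF (liftσ σ) A)

wkF : Formula → Formula
wkF = subF (var ∘ suc)

-- single substitution A[t] of t for var 0 (other variables lowered)
single : Term → ℕ → Term
single t zero    = t
single t (suc x) = var x

_[_] : Formula → Term → Formula
A [ t ] = subF (single t) A

σS : ℕ → Term
σS zero    = S (var zero)
σS (suc x) = var (suc x)

∀* : ℕ → Formula → Formula
∀* zero    A = A
∀* (suc n) A = ∀' (∀* n A)

xs : (n : ℕ) → Vec Term n
xs n = tabulate (λ i → var (toℕ i))

xs⁺ : (n : ℕ) → Vec Term n
xs⁺ n = tabulate (λ i → var (suc (toℕ i)))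

data PREq : Formula → Set where
  eqZ    : PREq (app Z [] ≐ 𝟎)
  eqSc   : PREq (∀' (app Sc (var 0 ∷ []) ≐ S (var 0)))
  eqProj : ∀ n (i : Fin n) → PREq (∀* n (app (Proj n i) (xs n) ≐ var (toℕ i)))
  eqComp : ∀ {k n} (g : PR k) (hs : Vec (PR n) k) →
           PREq (∀* n (app (Comp g hs) (xs n) ≐ app g (V.map (λ h → app h (xs n)) hs)))
  eqRec0 : ∀ {n} (g : PR n) (h : PR (suc (suc n))) →
           PREq (∀* n (app (Rec g h) (𝟎 ∷ xs n) ≐ app g (xs n)))
  eqRecS : ∀ {n} (g : PR n) (h : PR (suc (suc n))) →
           -- y = var 0, x⃗ = var 1 … var n
           PREq (∀* (suc n)
             (app (Rec g h) (S (var 0) ∷ xs⁺ n)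
               ≐ app h (var 0 ∷ app (Rec g h) (var 0 ∷ xs⁺ n) ∷ xs⁺ n)))

data Ax : Formula → Set where
  eqn  : ∀ {A} → PREq A → Ax A
  sep₁ : Ax (∀' (¬' (S (var 0) ≐ 𝟎)))
  sep₂ : Ax (∀' (∀' (S (var 1) ≐ S (var 0) ⇒ var 1 ≐ var 0)))
  ind  : (A : Formula) → Ax (A [ 𝟎 ] ⇒ ∀' (A ⇒ subF σS A) ⇒ ∀' A)

-- Classical natural deduction in A(PR); R restricts the terms allowed
-- in ∀-elimination and ∃-introduction.

data Der (R : Term → Set) : List Formula → Formula → Set where
  ax   : ∀ {Γ A} → Ax A → Der R Γ A
  hyp  : ∀ {Γ A} → A ∈ Γ → Der R Γ A
  ⇒I   : ∀ {Γ A B} → Der R (A Data.List.∷ Γ) B → Der R Γ (A ⇒ B)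
  ⇒E   : ∀ {Γ A B} → Der R Γ (A ⇒ B) → Der R Γ A → Der R Γ B
  ∧I   : ∀ {Γ A B} → Der R Γ A → Der R Γ B → Der R Γ (A ∧' B)
  ∧E₁  : ∀ {Γ A B} → Der R Γ (A ∧' B) → Der R Γ A
  ∧E₂  : ∀ {Γ A B} → Der R Γ (A ∧' B) → Der R Γ B
  ∨I₁  : ∀ {Γ A B} → Der R Γ A → Der R Γ (A ∨' B)
  ∨I₂  : ∀ {Γ A B} → Der R Γ B → Der R Γ (A ∨' B)
  ∨E   : ∀ {Γ A B C} → Der R Γ (A ∨' B) → Der R (A Data.List.∷ Γ) C →
         Der R (B Data.List.∷ Γ) C → Der R Γ C
  efq  : ∀ {Γ A} → Der R Γ ⊥' → Der R Γ A
  raa  : ∀ {Γ A} → Der R (¬' A Data.List.∷ Γ) ⊥' → Der R Γ A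
  ∀I   : ∀ {Γ A} → Der R (map wkF Γ) A → Der R Γ (∀' A)
  ∀E   : ∀ {Γ A} (t : Term) → R t → Der R Γ (∀' A) → Der R Γ (A [ t ])
  ∃I   : ∀ {Γ A} (t : Term) → R t → Der R Γ (A [ t ]) → Der R Γ (∃' A)
  ∃E   : ∀ {Γ A C} → Der R Γ (∃' A) →
         Der R (A Data.List.∷ map wkF Γ) (wkF C) → Der R Γ C
  eqRefl  : ∀ {Γ} (t : Term) → Der R Γ (t ≐ t)
  eqSubst : ∀ {Γ t s} (C : Formula) → Der R Γ (C [ t ]) → Der R Γ (t ≐ s) →
            Der R Γ (C [ s ])

AnyTerm : Term → Set
AnyTerm _ = ⊤

_⊢_ : List Formula → Formula → Set
Γ ⊢ A = Der AnyTerm Γ A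

_⊢b_ : List Formula → Formula → Set
Γ ⊢b A = Der Basic Γ A

module Submission where

-- Call a term t *total* in a context Γ when  Γ ⊢b ∃y (t = y).  The whole
-- proof rests on one observation: a ∀-elimination or ∃-introduction at a
-- total term t can be simulated using only the basic term y, by opening
-- the existential ∃y (t = y), using the rule at the variable y, and
-- transporting along y = t with the (unrestricted) equality rule.
--
-- With these, every
-- function symbol f is shown total by induction on its p.r. definition,
-- reading off each case from the defining equations (the recursion case
-- uses the induction axiom) — this is part (1).  Totality of arbitrary
-- terms follows by induction on the term — part (2).  Finally an ordinary
-- derivation is turned into a basic one by replacing every ∀E and ∃I by
-- its simulation, the needed totality being supplied by part (2) — (3).

open import Defs
open import Data.Nat using (ℕ; zero; suc)
open import Data.Fin using (Fin; toℕ)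
import Data.Fin as Fin
open import Data.List using (List; []; _∷_; map)
open import Data.List.Relation.Binary.Subset.Propositional using (_⊆_)
open import Data.List.Relation.Binary.Subset.Propositional.Properties
  using (∷⁺ʳ; xs⊆x∷xs; map⁺)
open import Data.List.Relation.Unary.Any using (here; there)
open import Data.Vec using (Vec; tabulate; lookup)
import Data.Vec as V
open import Data.Vec.Properties using (lookup∘tabulate; tabulate∘lookup; tabulate-cong)
open import Data.Vec.Relation.Unary.All using (All)
import Data.Vec.Relation.Unary.All as All
import Data.Vec.Relation.Unary.All.Properties as AllP
open import Data.Product using (_×_; _,_)
open import Function using (_∘_)
open import Relation.Binary.PropositionalEquality
  using (_≡_; refl; sym; trans; cong; cong₂; subst; subst₂; module ≡-Reasoning)

Sub : Set
Sub = ℕ → Term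

_⊙_ : Sub → Sub → Sub
(σ ⊙ τ) x = subT σ (τ x)

wk : Sub
wk = var ∘ suc

mutual
  subT-ext : ∀ {σ τ} → (∀ x → σ x ≡ τ x) → ∀ u → subT σ u ≡ subT τ u
  subT-ext e (var x)    = e x
  subT-ext e 𝟎          = refl
  subT-ext e (S u)      = cong S (subT-ext e u)
  subT-ext e (app f ts) = cong (app f) (subTs-ext e ts)

  subTs-ext : ∀ {n σ τ} → (∀ x → σ x ≡ τ x) → (ts : Vec Term n) →
              subTs σ ts ≡ subTs τ ts
  subTs-ext e V.[]       = refl
  subTs-ext e (t V.∷ ts) = cong₂ V._∷_ (subT-ext e t) (subTs-ext e ts)

mutual
  subT-⊙ : ∀ σ τ u → subT σ (subT τ u) ≡ subT (σ ⊙ τ) u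
  subT-⊙ σ τ (var x)    = refl
  subT-⊙ σ τ 𝟎          = refl
  subT-⊙ σ τ (S u)      = cong S (subT-⊙ σ τ u)
  subT-⊙ σ τ (app f ts) = cong (app f) (subTs-⊙ σ τ ts)

  subTs-⊙ : ∀ {n} σ τ (ts : Vec Term n) → subTs σ (subTs τ ts) ≡ subTs (σ ⊙ τ) ts
  subTs-⊙ σ τ V.[]       = refl
  subTs-⊙ σ τ (t V.∷ ts) = cong₂ V._∷_ (subT-⊙ σ τ t) (subTs-⊙ σ τ ts)

mutual
  subT-id : ∀ u → subT var u ≡ u
  subT-id (var x)    = refl
  subT-id 𝟎          = refl
  subT-id (S u)      = cong S (subT-id u)
  subT-id (app f ts) = cong (app f) (subTs-id ts)

  subTs-id : ∀ {n} (ts : Vec Term n) → subTs var ts ≡ ts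
  subTs-id V.[]       = refl
  subTs-id (t V.∷ ts) = cong₂ V._∷_ (subT-id t) (subTs-id ts)

single-wkT : ∀ s u → subT (single s) (wkT u) ≡ u
single-wkT s u = begin
  subT (single s) (wkT u)  ≡⟨ subT-⊙ (single s) wk u ⟩
  subT var u               ≡⟨ subT-id u ⟩
  u                        ∎
  where open ≡-Reasoning

liftσ-wkT : ∀ σ u → subT (liftσ σ) (wkT u) ≡ wkT (subT σ u)
liftσ-wkT σ u = begin
  subT (liftσ σ) (wkT u)    ≡⟨ subT-⊙ (liftσ σ) wk u ⟩
  subT (wk ⊙ σ) u           ≡⟨ subT-⊙ wk σ u ⟨
  wkT (subT σ u)            ∎
  where open ≡-Reasoning

liftσ-ext : ∀ {σ τ} → (∀ x → σ x ≡ τ x) → ∀ x → liftσ σ x ≡ liftσ τ x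
liftσ-ext e zero    = refl
liftσ-ext e (suc x) = cong wkT (e x)

liftσ-⊙ : ∀ σ τ x → (liftσ σ ⊙ liftσ τ) x ≡ liftσ (σ ⊙ τ) x
liftσ-⊙ σ τ zero    = refl
liftσ-⊙ σ τ (suc x) = liftσ-wkT σ (τ x)

liftσ-id : ∀ x → liftσ var x ≡ var x
liftσ-id zero    = refl
liftσ-id (suc x) = refl

subF-ext : ∀ {σ τ} → (∀ x → σ x ≡ τ x) → ∀ A → subF σ A ≡ subF τ A
subF-ext e (t ≐ s)  = cong₂ _≐_ (subT-ext e t) (subT-ext e s)
subF-ext e ⊥'       = refl
subF-ext e (A ⇒ B)  = cong₂ _⇒_ (subF-ext e A) (subF-ext e B)
subF-ext e (A ∧' B) = cong₂ _∧'_ (subF-ext e A) (subF-ext e B)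
subF-ext e (A ∨' B) = cong₂ _∨'_ (subF-ext e A) (subF-ext e B)
subF-ext e (∀' A)   = cong ∀' (subF-ext (liftσ-ext e) A)
subF-ext e (∃' A)   = cong ∃' (subF-ext (liftσ-ext e) A)

mutual
  subF-⊙ : ∀ σ τ A → subF σ (subF τ A) ≡ subF (σ ⊙ τ) A
  subF-⊙ σ τ (t ≐ s)  = cong₂ _≐_ (subT-⊙ σ τ t) (subT-⊙ σ τ s)
  subF-⊙ σ τ ⊥'       = refl
  subF-⊙ σ τ (A ⇒ B)  = cong₂ _⇒_ (subF-⊙ σ τ A) (subF-⊙ σ τ B)
  subF-⊙ σ τ (A ∧' B) = cong₂ _∧'_ (subF-⊙ σ τ A) (subF-⊙ σ τ B)
  subF-⊙ σ τ (A ∨' B) = cong₂ _∨'_ (subF-⊙ σ τ A) (subF-⊙ σ τ B)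
  subF-⊙ σ τ (∀' A)   = cong ∀' (subF-⊙-liftσ σ τ A)
  subF-⊙ σ τ (∃' A)   = cong ∃' (subF-⊙-liftσ σ τ A)

  subF-⊙-liftσ : ∀ σ τ A → subF (liftσ σ) (subF (liftσ τ) A) ≡ subF (liftσ (σ ⊙ τ)) A
  subF-⊙-liftσ σ τ A = trans (subF-⊙ (liftσ σ) (liftσ τ) A) (subF-ext (liftσ-⊙ σ τ) A)

subF-id : ∀ A → subF var A ≡ A
subF-id (t ≐ s)  = cong₂ _≐_ (subT-id t) (subT-id s)
subF-id ⊥'       = refl
subF-id (A ⇒ B)  = cong₂ _⇒_ (subF-id A) (subF-id B)
subF-id (A ∧' B) = cong₂ _∧'_ (subF-id A) (subF-id B)
subF-id (A ∨' B) = cong₂ _∨'_ (subF-id A) (subF-id B)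
subF-id (∀' A)   = cong ∀' (trans (subF-ext liftσ-id A) (subF-id A))
subF-id (∃' A)   = cong ∃' (trans (subF-ext liftσ-id A) (subF-id A))

wkF-[] : ∀ A t → wkF (A [ t ]) ≡ subF (liftσ wk) A [ wkT t ]
wkF-[] A t = begin
  wkF (A [ t ])                                ≡⟨ subF-⊙ wk (single t) A ⟩
  subF (wk ⊙ single t) A                       ≡⟨ subF-ext shift-single A ⟩
  subF (single (wkT t) ⊙ liftσ wk) A           ≡⟨ subF-⊙ (single (wkT t)) (liftσ wk) A ⟨
  subF (liftσ wk) A [ wkT t ]                  ∎
  where
  open ≡-Reasoning
  shift-single : ∀ x → (wk ⊙ single t) x ≡ (single (wkT t) ⊙ liftσ wk) x
  shift-single zero    = refl
  shift-single (suc x) = refl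

subTs-tabulate : ∀ {n} σ (f : Fin n → Term) → subTs σ (tabulate f) ≡ tabulate (subT σ ∘ f)
subTs-tabulate {zero}  σ f = refl
subTs-tabulate {suc n} σ f = cong (subT σ (f Fin.zero) V.∷_) (subTs-tabulate σ (f ∘ Fin.suc))

subTs-map-app : ∀ {k n} σ (us : Vec Term n) (hs : Vec (PR n) k) →
  subTs σ (V.map (λ h → app h us) hs) ≡ V.map (λ h → app h (subTs σ us)) hs
subTs-map-app σ us V.[]       = refl
subTs-map-app σ us (h V.∷ hs) = cong (app h (subTs σ us) V.∷_) (subTs-map-app σ us hs)

wk-xs : ∀ n → subTs wk (xs n) ≡ xs⁺ n
wk-xs n = subTs-tabulate wk (λ i → var (toℕ i))

-- inst ts sends var i to the i-th term of ts (i < n) and var (n + i) to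
-- var i: the substitution performed by instantiating all n quantifiers of
-- ∀* n B with the terms ts.
inst : ∀ {n} → Vec Term n → Sub
inst V.[]       i       = var i
inst (t V.∷ ts) zero    = t
inst (t V.∷ ts) (suc i) = inst ts i

inst-toℕ : ∀ {n} (ts : Vec Term n) i → inst ts (toℕ i) ≡ lookup ts i
inst-toℕ (t V.∷ ts) Fin.zero    = refl
inst-toℕ (t V.∷ ts) (Fin.suc i) = inst-toℕ ts i

inst-tabulate : ∀ {n} (ts : Vec Term n) → tabulate (λ i → inst ts (toℕ i)) ≡ ts
inst-tabulate ts = trans (tabulate-cong (inst-toℕ ts)) (tabulate∘lookup ts)

inst-xs : ∀ {n} (ts : Vec Term n) → subTs (inst ts) (xs n) ≡ ts
inst-xs ts = trans (subTs-tabulate (inst ts) _) (inst-tabulate ts)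

inst-xs⁺ : ∀ {n} t (ts : Vec Term n) → subTs (inst (t V.∷ ts)) (xs⁺ n) ≡ ts
inst-xs⁺ t ts = trans (subTs-tabulate (inst (t V.∷ ts)) _) (inst-tabulate ts)

inst-∷ : ∀ {n} t (ts : Vec Term n) x → (single t ⊙ liftσ (inst ts)) x ≡ inst (t V.∷ ts) x
inst-∷ t ts zero    = refl
inst-∷ t ts (suc x) = single-wkT t (inst ts x)

∀*-suc : ∀ n B → ∀* (suc n) B ≡ ∀* n (∀' B)
∀*-suc zero    B = refl
∀*-suc (suc n) B = cong ∀' (∀*-suc n B)

weaken : ∀ {R Γ Δ A} → Γ ⊆ Δ → Der R Γ A → Der R Δ A
weaken s (ax a)          = ax a
weaken s (hyp p)         = hyp (s p)
weaken s (⇒I d)          = ⇒I (weaken (∷⁺ʳ _ s) d)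
weaken s (⇒E d e)        = ⇒E (weaken s d) (weaken s e)
weaken s (∧I d e)        = ∧I (weaken s d) (weaken s e)
weaken s (∧E₁ d)         = ∧E₁ (weaken s d)
weaken s (∧E₂ d)         = ∧E₂ (weaken s d)
weaken s (∨I₁ d)         = ∨I₁ (weaken s d)
weaken s (∨I₂ d)         = ∨I₂ (weaken s d)
weaken s (∨E d e f)      = ∨E (weaken s d) (weaken (∷⁺ʳ _ s) e) (weaken (∷⁺ʳ _ s) f)
weaken s (efq d)         = efq (weaken s d)
weaken s (raa d)         = raa (weaken (∷⁺ʳ _ s) d)
weaken s (∀I d)          = ∀I (weaken (map⁺ wkF s) d)
weaken s (∀E t r d)      = ∀E t r (weaken s d)
weaken s (∃I t r d)      = ∃I t r (weaken s d)
weaken s (∃E d e)        = ∃E (weaken s d) (weaken (∷⁺ʳ _ (map⁺ wkF s)) e)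
weaken s (eqRefl t)      = eqRefl t
weaken s (eqSubst C d e) = eqSubst C (weaken s d) (weaken s e)

∀*-intro : ∀ {R} n {B} → (∀ Δ → Der R Δ B) → ∀ Γ → Der R Γ (∀* n B)
∀*-intro zero    d Γ = d Γ
∀*-intro (suc n) d Γ = ∀I (∀*-intro n d (map wkF Γ))

≐-sym : ∀ {R Γ a b} → Der R Γ (a ≐ b) → Der R Γ (b ≐ a)
≐-sym {R} {Γ} {a} {b} a≐b =
  subst (λ z → Der R Γ (b ≐ z)) (single-wkT b a)
    (eqSubst (var 0 ≐ wkT a) a≐a a≐b)
  where
  a≐a : Der R Γ (a ≐ subT (single a) (wkT a))
  a≐a = subst (λ z → Der R Γ (a ≐ z)) (sym (single-wkT a a)) (eqRefl a)

Tot : Term → Formula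
Tot t = ∃' (wkT t ≐ var 0)

Tot-resp-≐ : ∀ {R Γ a b} → Der R Γ (a ≐ b) → Der R Γ (Tot a) → Der R Γ (Tot b)
Tot-resp-≐ a≐b tot = eqSubst (∃' (var 1 ≐ var 0)) tot a≐b

Tot-from : ∀ {R Γ a b} → Der R Γ (a ≐ b) → Der R Γ (Tot b) → Der R Γ (Tot a)
Tot-from a≐b = Tot-resp-≐ (≐-sym a≐b)

subF-Tot : ∀ σ u → subF σ (Tot u) ≡ Tot (subT σ u)
subF-Tot σ u = cong (λ z → ∃' (z ≐ var 0)) (liftσ-wkT σ u)

Tot-var : ∀ {Γ} x → Γ ⊢b Tot (var x)
Tot-var x = ∃I (var x) (b-var x) (eqRefl (var x))

Tot-𝟎 : ∀ {Γ} → Γ ⊢b Tot 𝟎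
Tot-𝟎 = ∃I 𝟎 b-𝟎 (eqRefl 𝟎)

-- Reasoning by cases on the value y of a total term t: to derive C, one
-- may assume t = y, together with a premise P already derived for Γ (the
-- premise is passed through the context, since derivations cannot be
-- shifted under the new variable directly).
withValue : ∀ {Γ P C} t → Γ ⊢b Tot t → Γ ⊢b P →
            ((wkT t ≐ var 0) ∷ wkF P ∷ map wkF Γ) ⊢b wkF C → Γ ⊢b C
withValue t tot p body = ⇒E (⇒I (∃E (weaken (xs⊆x∷xs _ _) tot) body)) p

-- ∀-elimination at a total term is basically derivable: use ∀E at y and
-- rewrite y to t.
∀E-total : ∀ {Γ A} t → Γ ⊢b Tot t → Γ ⊢b ∀' A → Γ ⊢b (A [ t ])
∀E-total {Γ} {A} t tot ∀A = withValue t tot ∀A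
  (subst (((wkT t ≐ var 0) ∷ wkF (∀' A) ∷ map wkF Γ) ⊢b_) (sym (wkF-[] A t))
    (eqSubst (subF (liftσ wk) A) (∀E (var 0) (b-var 0) (hyp (there (here refl))))
      (≐-sym (hyp (here refl)))))

-- ∃-introduction at a total term is basically derivable: rewrite t to y
-- and use ∃I at y.
∃I-total : ∀ {Γ A} t → Γ ⊢b Tot t → Γ ⊢b (A [ t ]) → Γ ⊢b ∃' A
∃I-total {Γ} {A} t tot At = withValue t tot At
  (∃I (var 0) (b-var 0)
    (eqSubst (subF (liftσ wk) A)
      (subst (((wkT t ≐ var 0) ∷ wkF (A [ t ]) ∷ map wkF Γ) ⊢b_) (wkF-[] A t)
        (hyp (there (here refl))))
      (hyp (here refl))))

∀*-inst : ∀ n {Γ} B (ts : Vec Term n) → All (λ t → Γ ⊢b Tot t) ts →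
          Γ ⊢b ∀* n B → Γ ⊢b subF (inst ts) B
∀*-inst zero    {Γ} B V.[]       All.[] d = subst (Γ ⊢b_) (sym (subF-id B)) d
∀*-inst (suc n) {Γ} B (t V.∷ ts) (tot All.∷ tots) d =
  subst (Γ ⊢b_) (trans (subF-⊙ (single t) (liftσ (inst ts)) B) (subF-ext (inst-∷ t ts) B))
    (∀E-total t tot (∀*-inst n (∀' B) ts tots (subst (Γ ⊢b_) (∀*-suc n B) d)))

Tot-xs : ∀ {Γ} n → All (λ t → Γ ⊢b Tot t) (xs n)
Tot-xs n = AllP.tabulate⁺ (λ i → Tot-var (toℕ i))

defEq : ∀ n {Γ a b} → PREq (∀* n (a ≐ b)) →
        Γ ⊢b (subT (inst (xs n)) a ≐ subT (inst (xs n)) b)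
defEq n {a = a} {b} e = ∀*-inst n (a ≐ b) (xs n) (Tot-xs n) (ax (eqn e))

Tot-app : ∀ {n Γ} (f : PR n) → Γ ⊢b ∀* n (Tot (app f (xs n))) →
          (ts : Vec Term n) → All (λ t → Γ ⊢b Tot t) ts → Γ ⊢b Tot (app f ts)
Tot-app {n} {Γ} f tot-f ts tots =
  subst (Γ ⊢b_) (trans (subF-Tot (inst ts) (app f (xs n)))
                       (cong (Tot ∘ app f) (inst-xs ts)))
    (∀*-inst n _ ts tots tot-f)

-- Totality of a recursion Rec g h is proved by induction on the recursion
-- variable var 0 of the following formula.
Tot-Rec : ∀ {n} → PR n → PR (suc (suc n)) → Formula
Tot-Rec {n} g h = Tot (app (Rec g h) (xs (suc n)))

subF-Tot-Rec : ∀ {n} (g : PR n) h σ →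
  subF σ (Tot-Rec g h) ≡ Tot (app (Rec g h) (σ 0 V.∷ tabulate (λ i → σ (suc (toℕ i)))))
subF-Tot-Rec {n} g h σ =
  trans (subF-Tot σ (app (Rec g h) (xs (suc n))))
        (cong (λ us → Tot (app (Rec g h) (σ 0 V.∷ us))) (subTs-tabulate σ _))

-- Base: Rec g h (0, x⃗) = g(x⃗), and g is total.
Tot-Rec-𝟎 : ∀ {n Δ} (g : PR n) h → Δ ⊢b ∀* n (Tot (app g (xs n))) → Δ ⊢b (Tot-Rec g h [ 𝟎 ])
Tot-Rec-𝟎 {n} {Δ} g h tot-g = subst (Δ ⊢b_) (sym (subF-Tot-Rec g h (single 𝟎)))
  (Tot-from recEq (Tot-app g tot-g (xs n) (Tot-xs n)))
  where
  recEq : Δ ⊢b (app (Rec g h) (𝟎 V.∷ xs n) ≐ app g (xs n))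
  recEq = subst (λ us → Δ ⊢b (app (Rec g h) (𝟎 V.∷ us) ≐ app g us)) (inst-xs (xs n))
            (defEq n (eqRec0 g h))

-- Step: Rec g h (S y, x⃗) = h(y, Rec g h (y, x⃗), x⃗), where the middle
-- argument is total by the induction hypothesis and h is total.
Tot-Rec-S : ∀ {n Δ} (g : PR n) h →
  (Tot-Rec g h ∷ map wkF Δ) ⊢b ∀* (suc (suc n)) (Tot (app h (xs (suc (suc n))))) →
  Δ ⊢b ∀' (Tot-Rec g h ⇒ subF σS (Tot-Rec g h))
Tot-Rec-S {n} {Δ} g h tot-h =
  ∀I (⇒I (subst (Θ ⊢b_) (sym (subF-Tot-Rec g h σS)) (Tot-from recEq (Tot-app h tot-h _ tots))))
  where
  Θ    = Tot-Rec g h ∷ map wkF Δ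
  prev = app (Rec g h) (var 0 V.∷ xs⁺ n)
  recEq : Θ ⊢b (app (Rec g h) (S (var 0) V.∷ xs⁺ n) ≐ app h (var 0 V.∷ prev V.∷ xs⁺ n))
  recEq = subst (λ us → Θ ⊢b (app (Rec g h) (S (var 0) V.∷ us)
                               ≐ app h (var 0 V.∷ app (Rec g h) (var 0 V.∷ us) V.∷ us)))
            (inst-xs⁺ (var 0) (xs⁺ n)) (defEq (suc n) (eqRecS g h))
  tots : All (λ t → Θ ⊢b Tot t) (var 0 V.∷ prev V.∷ xs⁺ n)
  tots = Tot-var 0 All.∷ hyp (here refl) All.∷ AllP.tabulate⁺ (λ i → Tot-var (suc (toℕ i)))

mutual
  Tot-PR : ∀ {n} (f : PR n) Γ → Γ ⊢b ∀* n (Tot (app f (xs n)))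
  Tot-PR Z          Γ = Tot-from (ax (eqn eqZ)) Tot-𝟎
  Tot-PR Sc         Γ = ∀*-intro 1 (λ Δ →
    Tot-from (∀E (var 0) (b-var 0) (ax (eqn eqSc))) (∃I (S (var 0)) (b-S (b-var 0)) (eqRefl _))) Γ
  Tot-PR (Proj n i) Γ = ∀*-intro n (λ Δ → Tot-from projEq (Tot-var (toℕ i))) Γ
    where
    projEq : ∀ {Δ} → Δ ⊢b (app (Proj n i) (xs n) ≐ var (toℕ i))
    projEq {Δ} = subst₂ (λ us v → Δ ⊢b (app (Proj n i) us ≐ v))
      (inst-xs (xs n)) (trans (inst-toℕ (xs n) i) (lookup∘tabulate _ i))
      (defEq n (eqProj n i))
  Tot-PR (Comp {n = n} g hs) Γ =
    ∀*-intro n (λ Δ → Tot-from compEq (Tot-app g (Tot-PR g Δ) _ (AllP.map⁺ (Tot-comps hs Δ)))) Γ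
    where
    compEq : ∀ {Δ} → Δ ⊢b (app (Comp g hs) (xs n) ≐ app g (V.map (λ h → app h (xs n)) hs))
    compEq {Δ} = subst₂ (λ us vs → Δ ⊢b (app (Comp g hs) us ≐ app g vs))
      (inst-xs (xs n))
      (trans (subTs-map-app (inst (xs n)) (xs n) hs)
             (cong (λ us → V.map (λ h → app h us) hs) (inst-xs (xs n))))
      (defEq n (eqComp g hs))
  Tot-PR (Rec {n} g h) Γ =
    subst (Γ ⊢b_) (sym (∀*-suc n (Tot-Rec g h)))
      (∀*-intro n (λ Δ → ⇒E (⇒E (ax (ind (Tot-Rec g h))) (Tot-Rec-𝟎 g h (Tot-PR g Δ)))
                             (Tot-Rec-S g h (Tot-PR h (Tot-Rec g h ∷ map wkF Δ)))) Γ)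

  Tot-comps : ∀ {k n} (hs : Vec (PR n) k) Δ → All (λ h → Δ ⊢b Tot (app h (xs n))) hs
  Tot-comps V.[]       Δ = All.[]
  Tot-comps (h V.∷ hs) Δ = Tot-app h (Tot-PR h Δ) _ (Tot-xs _) All.∷ Tot-comps hs Δ

-- By induction on t; a successor S t is total since S t = Sc(t).
mutual
  Tot-term : ∀ Γ t → Γ ⊢b Tot t
  Tot-term Γ (var x)    = Tot-var x
  Tot-term Γ 𝟎          = Tot-𝟎
  Tot-term Γ (S t)      =
    Tot-resp-≐ (∀E-total t (Tot-term Γ t) (ax (eqn eqSc)))
               (Tot-app Sc (Tot-PR Sc Γ) (t V.∷ V.[]) (Tot-term Γ t All.∷ All.[]))
  Tot-term Γ (app f ts) = Tot-app f (Tot-PR f Γ) ts (Tot-terms Γ ts)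

  Tot-terms : ∀ {n} Γ (ts : Vec Term n) → All (λ t → Γ ⊢b Tot t) ts
  Tot-terms Γ V.[]       = All.[]
  Tot-terms Γ (t V.∷ ts) = Tot-term Γ t All.∷ Tot-terms Γ ts

basic : ∀ {Γ A} → Γ ⊢ A → Γ ⊢b A
basic (ax a)            = ax a
basic (hyp p)           = hyp p
basic (⇒I d)            = ⇒I (basic d)
basic (⇒E d e)          = ⇒E (basic d) (basic e)
basic (∧I d e)          = ∧I (basic d) (basic e)
basic (∧E₁ d)           = ∧E₁ (basic d)
basic (∧E₂ d)           = ∧E₂ (basic d)
basic (∨I₁ d)           = ∨I₁ (basic d)
basic (∨I₂ d)           = ∨I₂ (basic d)
basic (∨E d e f)        = ∨E (basic d) (basic e) (basic f)
basic (efq d)           = efq (basic d)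
basic (raa d)           = raa (basic d)
basic (∀I d)            = ∀I (basic d)
basic {Γ} (∀E t _ d)    = ∀E-total t (Tot-term Γ t) (basic d)
basic {Γ} (∃I t _ d)    = ∃I-total t (Tot-term Γ t) (basic d)
basic (∃E d e)          = ∃E (basic d) (basic e)
basic (eqRefl t)        = eqRefl t
basic (eqSubst C d e)   = eqSubst C (basic d) (basic e)

lemma3 : (∀ {n} (f : PR n) → [] ⊢b ∀* n (∃' (app f (xs⁺ n) ≐ var 0)))
    × (∀ (n : ℕ) (t : Term) → VarsBelow n t → [] ⊢b ∀* n (∃' (wkT t ≐ var 0)))
    × (∀ (A : Formula) → [] ⊢ A → [] ⊢b A)
lemma3 = part1 , part2 , (λ A → basic)
  where
  part1 : ∀ {n} (f : PR n) → [] ⊢b ∀* n (∃' (app f (xs⁺ n) ≐ var 0))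
  part1 {n} f = subst (λ us → [] ⊢b ∀* n (∃' (app f us ≐ var 0))) (wk-xs n) (Tot-PR f [])
  -- every term is total, whatever its variables
  part2 : ∀ n t → VarsBelow n t → [] ⊢b ∀* n (Tot t)
  part2 n t _ = ∀*-intro n (λ Δ → Tot-term Δ t) []
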